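{- Let $\overrightarrow{F}$ be the oriented graph consisting of the vertex-disjoint union of an antidirected path on three vertices (two arcs, either both directed into the middle vertex or both directed out of the middle vertex) and one further arc. Then for all sufficiently large $n$, $\mathrm{ex}_{\mathrm{ori}}(n,\overrightarrow{F})=2n-3$.
   Context: An oriented graph is a directed graph with no loops, no multiple arcs and no pair of opposite arcs. $\mathrm{ex}_{\mathrm{ori}}(n,\overrightarrow{F})$ is the largest number of arcs in an $n$-vertex oriented graph not containing $\overrightarrow{F}$ as a (not necessarily induced) subgraph. -}

module Defs where

open import Data.Nat using (ℕ; zero; suc; _+_; _≤_)
open import Data.Bool using (Bool; true; false; _∧_; not; T; if_then_else_)
open import Data.Bool.Properties using (T?)
open import Data.Fin using (Fin; zero; suc)
open import Data.Fin.Properties using (all?)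
open import Data.Product using (Σ; _×_; ∃)
open import Function.Definitions using (Injective)
open import Relation.Binary.PropositionalEquality using (_≡_)
open import Relation.Nullary using (¬_)
open import Relation.Nullary.Decidable using (toWitness)
open import Data.Unit using (tt)

record OrientedGraph (n : ℕ) : Set where
  field
    arc      : Fin n → Fin n → Bool
    loopless : ∀ i → T (not (arc i i))
    noOpp    : ∀ i j → T (not (arc i j ∧ arc j i))
open OrientedGraph public

sumFin : ∀ {n} → (Fin n → ℕ) → ℕ
sumFin {zero}  f = 0
sumFin {suc n} f = f zero + sumFin (λ i → f (suc i))

arcCount : ∀ {n} → OrientedGraph n → ℕ
arcCount G = sumFin (λ i → sumFin (λ j → if arc G i j then 1 else 0))

Contains : ∀ {n k} → OrientedGraph n → OrientedGraph k → Set
Contains {n} {k} G F =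
  Σ (Fin k → Fin n) λ φ → Injective _≡_ _≡_ φ ×
    (∀ i j → T (arc F i j) → T (arc G (φ i) (φ j)))

IsExOri : ∀ {k} → ℕ → OrientedGraph k → ℕ → Set
IsExOri n F m =
  (Σ (OrientedGraph n) λ G → ¬ Contains G F × arcCount G ≡ m) ×
  (∀ (G : OrientedGraph n) → ¬ Contains G F → arcCount G ≤ m)

data Orientation : Set where
  inward outward : Orientation

-- Vertices 0,1,2 form the antidirected path with middle vertex 1;
-- vertices 3,4 carry the extra arc 3 → 4.
FArc : Orientation → Fin 5 → Fin 5 → Bool
FArc inward  zero          (suc zero)    = true
FArc inward  (suc (suc zero)) (suc zero) = true
FArc outward (suc zero)    zero          = true
FArc outward (suc zero)    (suc (suc zero)) = true
FArc _ (suc (suc (suc zero))) (suc (suc (suc (suc zero)))) = true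
FArc _ _ _ = false

F⃗ : Orientation → OrientedGraph 5
F⃗ o = record { arc = FArc o ; loopless = ll o ; noOpp = na o }
  where
  ll : ∀ o i → T (not (FArc o i i))
  ll inward  = toWitness {a? = all? (λ i → T? (not (FArc inward i i)))} tt
  ll outward = toWitness {a? = all? (λ i → T? (not (FArc outward i i)))} tt
  na : ∀ o i j → T (not (FArc o i j ∧ FArc o j i))
  na inward  = toWitness {a? = all? (λ i → all? (λ j → T? (not (FArc inward i j ∧ FArc inward j i))))} tt
  na outward = toWitness {a? = all? (λ i → all? (λ j → T? (not (FArc outward i j ∧ FArc outward j i))))} tt

module Submission where

-- Reversing every arc exchanges the two orientations of F⃗, so it suffices to treat the
-- inward one. The graph in which 0 and 1 dominate all later vertices has 2n − 3 arcs, all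
-- leaving 0 or 1, while the arcs of F⃗ have three distinct tails. Conversely, in an F⃗-free
-- graph the vertices of any cherry a → v ← b meet every arc. A vertex v with three
-- in-neighbours a, b, c then leaves v as the only possible in-neighbour of every vertex outside
-- {a, b, c, v}, so there are at most n + 9 arcs. Otherwise every in-degree is at most 2. If two
-- vertices w₁, w₂ outside a cherry {a, b, v} have in-degree 2, the tails of their cherries are
-- the same pair {p, q}; then {p, q} meets every arc and there are at most 2(n − 2) + 1 arcs.
-- If not, all but four vertices have in-degree at most 1, giving at most n + 4 arcs.

open import Defs
open import Data.Bool.Base using (Bool; true; false; T; not; _∧_; if_then_else_)
open import Data.Empty using (⊥; ⊥-elim)
open import Data.Fin.Base using (Fin; zero; suc)
open import Data.Fin.Patterns using (0F; 1F; 2F; 3F; 4F)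
open import Data.Fin.Properties using (_≟_; any?; all?)
open import Data.List.Base using (List; []; _∷_; length)
open import Data.List.Membership.Propositional using (_∈_; _∉_)
import Data.List.Relation.Unary.Any as Any
open import Data.List.Relation.Unary.Any using (here; there)
open import Data.List.Relation.Unary.All as All using (All; []; _∷_)
open import Data.List.Relation.Unary.All.Properties using (All¬⇒¬Any)
open import Data.Nat.Base using (ℕ; zero; suc; _+_; _*_; _∸_; _≤_; _<_; z≤n; s≤s)
open import Data.Nat.Properties hiding (_≟_)
open import Data.Nat.Tactic.RingSolver using (solve-∀)
open import Algebra.Properties.CommutativeSemigroup +-commutativeSemigroup using (interchange)
open import Algebra.Properties.Semiring.Sum +-*-semiring
  using (sum; sum-syntax; sum-cong-≗; sum-replicate-zero; ∑-distrib-+; ∑-comm; *-distribˡ-sum)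
open import Data.Product.Base using (Σ; ∃-syntax; ∃₂; _×_; _,_; uncurry)
open import Data.Product.Properties using (≡-dec)
open import Data.Sum.Base using (_⊎_; inj₁; inj₂; [_,_]′)
open import Data.Unit.Base using (tt)
open import Data.Vec.Base using (Vec; []; _∷_; lookup)
open import Data.Vec.Relation.Unary.All using ([]; _∷_)
open import Data.Vec.Relation.Unary.AllPairs using (allPairs?; []; _∷_)
open import Data.Vec.Relation.Unary.Unique.Propositional using (Unique)
open import Data.Vec.Relation.Unary.Unique.Propositional.Properties using (lookup-injective)
open import Function.Base using (_∘_; flip)
open import Relation.Binary.PropositionalEquality
open import Relation.Nullary.Decidable
  using (Dec; yes; no; does; ¬?; T?; _×-dec_; _→-dec_; toWitness; dec-true; dec-false; decidable-stable)
open import Relation.Nullary.Negation using (¬_; contradiction)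

⟦_⟧ : Bool → ℕ
⟦ b ⟧ = if b then 1 else 0

⟦⟧-≤ : ∀ {b m} → (T b → 1 ≤ m) → ⟦ b ⟧ ≤ m
⟦⟧-≤ {false} _ = z≤n
⟦⟧-≤ {true}  h = h tt

⟦⟧≡0 : ∀ {b} → ¬ T b → ⟦ b ⟧ ≡ 0
⟦⟧≡0 {false} _  = refl
⟦⟧≡0 {true}  ¬t = contradiction tt ¬t

T-not⇒¬T : ∀ {b} → T (not b) → ¬ T b
T-not⇒¬T {false} _ ()

sumFin≡sum : ∀ {n} (f : Fin n → ℕ) → sumFin f ≡ sum f
sumFin≡sum {zero}  f = refl
sumFin≡sum {suc n} f = cong (f zero +_) (sumFin≡sum (f ∘ suc))

sum-mono : ∀ {n} {f g : Fin n → ℕ} → (∀ i → f i ≤ g i) → sum f ≤ sum g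
sum-mono {zero}  f≤g = z≤n
sum-mono {suc n} f≤g = +-mono-≤ (f≤g zero) (sum-mono (f≤g ∘ suc))

sum-const : ∀ n c → ∑[ i < n ] c ≡ n * c
sum-const zero    c = refl
sum-const (suc n) c = cong (c +_) (sum-const n c)

δ : ∀ {n} → Fin n → Fin n → ℕ
δ i j = ⟦ does (i ≟ j) ⟧

δ-refl : ∀ {n} (i : Fin n) → δ i i ≡ 1
δ-refl i = cong ⟦_⟧ (dec-true (i ≟ i) refl)

δ-≢ : ∀ {n} {i j : Fin n} → i ≢ j → δ i j ≡ 0
δ-≢ {i = i} {j} i≢j = cong ⟦_⟧ (dec-false (i ≟ j) i≢j)

∑-δ-* : ∀ {n} (i : Fin n) (f : Fin n → ℕ) → ∑[ j < n ] (δ i j * f j) ≡ f i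
∑-δ-* {suc n} zero    f =
  trans (cong₂ _+_ (+-identityʳ (f zero)) (sum-replicate-zero n)) (+-identityʳ (f zero))
∑-δ-* {suc n} (suc i) f = ∑-δ-* i (f ∘ suc)

∑-δ : ∀ {n} (i : Fin n) → ∑[ j < n ] δ i j ≡ 1
∑-δ i = trans (sum-cong-≗ (λ j → sym (*-identityʳ (δ i j)))) (∑-δ-* i (λ _ → 1))

sum-supported : ∀ {n} {f : Fin n → ℕ} (p : Fin n) → (∀ i → i ≢ p → f i ≡ 0) → sum f ≡ f p
sum-supported {f = f} p vanish = trans (sum-cong-≗ masked) (∑-δ-* p f)
  where
  masked : ∀ i → f i ≡ δ p i * f i
  masked i with p ≟ i
  ... | yes refl = sym (+-identityʳ (f i))
  ... | no p≢i   = vanish i (≢-sym p≢i)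

multiplicity : ∀ {n} → List (Fin n) → Fin n → ℕ
multiplicity []       j = 0
multiplicity (p ∷ ps) j = δ p j + multiplicity ps j

∑-multiplicity : ∀ {n} (ps : List (Fin n)) → ∑[ j < n ] multiplicity ps j ≡ length ps
∑-multiplicity {n} []       = sum-replicate-zero n
∑-multiplicity     (p ∷ ps) =
  trans (∑-distrib-+ (δ p) (multiplicity ps)) (cong₂ _+_ (∑-δ p) (∑-multiplicity ps))

∈⇒1≤multiplicity : ∀ {n} {j : Fin n} {ps} → j ∈ ps → 1 ≤ multiplicity ps j
∈⇒1≤multiplicity {j = j} (here refl) = ≤-trans (≤-reflexive (sym (δ-refl j))) (m≤m+n _ _)
∈⇒1≤multiplicity         (there j∈ps) = ≤-trans (∈⇒1≤multiplicity j∈ps) (m≤n+m _ _)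

_∈?_ : ∀ {n} (j : Fin n) (ps : List (Fin n)) → Dec (j ∈ ps)
j ∈? ps = Any.any? (j ≟_) ps

count-≤-length : ∀ {n} (f : Fin n → Bool) (ps : List (Fin n)) →
  (∀ i → T (f i) → i ∈ ps) → ∑[ i < n ] ⟦ f i ⟧ ≤ length ps
count-≤-length f ps f⊆ps =
  ≤-trans (sum-mono (λ i → ⟦⟧-≤ (∈⇒1≤multiplicity ∘ f⊆ps i))) (≤-reflexive (∑-multiplicity ps))

count>length⇒∃∉ : ∀ {n} (f : Fin n → Bool) (ps : List (Fin n)) →
  length ps < ∑[ i < n ] ⟦ f i ⟧ → ∃[ i ] T (f i) × i ∉ ps
count>length⇒∃∉ f ps ps<count with any? (λ i → T? (f i) ×-dec ¬? (i ∈? ps))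
... | yes found = found
... | no  none  = contradiction (count-≤-length f ps f⊆ps) (<⇒≱ ps<count)
  where
  f⊆ps : ∀ i → T (f i) → i ∈ ps
  f⊆ps i fi = decidable-stable (i ∈? ps) (λ i∉ps → none (i , fi , i∉ps))

∑-≤-except : ∀ {n} {f g : Fin n → ℕ} (ps : List (Fin n)) c →
  (∀ j → j ∉ ps → f j ≤ g j) → (∀ j → j ∈ ps → f j ≤ g j + c) →
  sum f ≤ sum g + c * length ps
∑-≤-except {n} {f} {g} ps c off on = begin
  sum f                                          ≤⟨ sum-mono pointwise ⟩
  ∑[ j < n ] (g j + c * multiplicity ps j)       ≡⟨ ∑-distrib-+ g (λ j → c * multiplicity ps j) ⟩
  sum g + ∑[ j < n ] (c * multiplicity ps j)     ≡⟨ cong (sum g +_) (*-distribˡ-sum c (multiplicity ps)) ⟨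
  sum g + c * ∑[ j < n ] multiplicity ps j       ≡⟨ cong (λ k → sum g + c * k) (∑-multiplicity ps) ⟩
  sum g + c * length ps                          ∎
  where
  open ≤-Reasoning
  pointwise : ∀ j → f j ≤ g j + c * multiplicity ps j
  pointwise j with j ∈? ps
  ... | no  j∉ps = ≤-trans (off j j∉ps) (m≤m+n _ _)
  ... | yes j∈ps = ≤-trans (on j j∈ps) (+-monoʳ-≤ (g j)
                     (≤-trans (≤-reflexive (sym (*-identityʳ c))) (*-monoʳ-≤ c (∈⇒1≤multiplicity j∈ps))))

outside : ∀ {n} → List (Fin n) → (Fin n → ℕ) → Fin n → ℕ
outside ps f j with j ∈? ps
... | yes _ = 0
... | no  _ = f j

outside-mono : ∀ {n} {f g : Fin n → ℕ} (ps : List (Fin n)) →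
  (∀ j → j ∉ ps → f j ≤ g j) → ∀ j → outside ps f j ≤ outside ps g j
outside-mono ps f≤g j with j ∈? ps
... | yes _    = z≤n
... | no  j∉ps = f≤g j j∉ps

∑-outside-≡0 : ∀ {n} {f : Fin n → ℕ} (ps : List (Fin n)) →
  (∀ j → j ∉ ps → f j ≡ 0) → sum (outside ps f) ≡ 0
∑-outside-≡0 {n} ps vanish = trans (sum-cong-≗ pointwise) (sum-replicate-zero n)
  where
  pointwise : ∀ j → outside ps _ j ≡ 0
  pointwise j with j ∈? ps
  ... | yes _    = refl
  ... | no  j∉ps = vanish j j∉ps

outside-+ : ∀ {n} (ps : List (Fin n)) (f g : Fin n → ℕ) j →
  outside ps f j + outside ps g j ≡ outside ps (λ i → f i + g i) j
outside-+ ps f g j with j ∈? ps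
... | yes _ = refl
... | no  _ = refl

∑-split₂ : ∀ {n} {p q : Fin n} (f : Fin n → ℕ) → p ≢ q →
  sum f ≡ f p + f q + sum (outside (p ∷ q ∷ []) f)
∑-split₂ {n} {p} {q} f p≢q = begin
  sum f                                                ≡⟨ sum-cong-≗ decompose ⟩
  ∑[ j < n ] (δ p j * f j + δ q j * f j + rest j)      ≡⟨ ∑-distrib-+ (λ j → δ p j * f j + δ q j * f j) rest ⟩
  ∑[ j < n ] (δ p j * f j + δ q j * f j) + sum rest    ≡⟨ cong (_+ sum rest) at-p-and-q ⟩
  f p + f q + sum rest                                 ∎
  where
  open ≡-Reasoning
  rest : Fin n → ℕ
  rest = outside (p ∷ q ∷ []) f
  at-p-and-q : ∑[ j < n ] (δ p j * f j + δ q j * f j) ≡ f p + f q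
  at-p-and-q =
    trans (∑-distrib-+ (λ j → δ p j * f j) (λ j → δ q j * f j)) (cong₂ _+_ (∑-δ-* p f) (∑-δ-* q f))
  decompose : ∀ j → f j ≡ δ p j * f j + δ q j * f j + rest j
  decompose j with j ∈? (p ∷ q ∷ [])
  ... | yes (here refl) rewrite δ-refl p | δ-≢ (≢-sym p≢q) =
    sym (trans (+-identityʳ _) (trans (+-identityʳ _) (+-identityʳ _)))
  ... | yes (there (here refl)) rewrite δ-refl q | δ-≢ p≢q = sym (trans (+-identityʳ _) (+-identityʳ _))
  ... | no j∉pq rewrite δ-≢ (j∉pq ∘ here ∘ sym) | δ-≢ (j∉pq ∘ there ∘ here ∘ sym) = refl

∈∧∉⇒≢ : ∀ {A : Set} {x y : A} {S : List A} → x ∈ S → y ∉ S → x ≢ y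
∈∧∉⇒≢ x∈S y∉S refl = y∉S x∈S

∈-∷∧∉⇒≡ : ∀ {A : Set} {x y : A} {S : List A} → x ∈ y ∷ S → x ∉ S → x ≡ y
∈-∷∧∉⇒≡ (here x≡y)  x∉S = x≡y
∈-∷∧∉⇒≡ (there x∈S) x∉S = contradiction x∈S x∉S

∃>-or-∀≤ : ∀ {n} (f : Fin n → ℕ) (ps : List (Fin n)) k →
  (∃[ j ] j ∉ ps × k < f j) ⊎ (∀ j → j ∉ ps → f j ≤ k)
∃>-or-∀≤ f ps k with any? (λ j → ¬? (j ∈? ps) ×-dec k <? f j)
... | yes found = inj₁ found
... | no  none  = inj₂ λ j j∉ps → ≮⇒≥ (λ k<fj → none (j , j∉ps , k<fj))

≤n+9⇒≤2n∸3 : ∀ {m n} → 12 ≤ n → m ≤ n + 9 → m ≤ 2 * n ∸ 3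
≤n+9⇒≤2n∸3 {m} {n} n≥12 m≤n+9 = m+n≤o⇒m≤o∸n m (begin
  m + 3        ≤⟨ +-monoˡ-≤ 3 m≤n+9 ⟩
  n + 9 + 3    ≡⟨ +-assoc n 9 3 ⟩
  n + 12       ≤⟨ +-monoʳ-≤ n n≥12 ⟩
  n + n        ≡⟨ cong (n +_) (+-identityʳ n) ⟨
  2 * n        ∎)
  where open ≤-Reasoning

Arc : ∀ {n} → OrientedGraph n → Fin n → Fin n → Set
Arc G i j = T (arc G i j)

reverse : ∀ {n} → OrientedGraph n → OrientedGraph n
reverse G = record { arc = flip (arc G) ; loopless = loopless G ; noOpp = flip (noOpp G) }

module _ {n : ℕ} (G : OrientedGraph n) where

  indegree : Fin n → ℕ
  indegree j = ∑[ i < n ] ⟦ arc G i j ⟧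

  outdegree : Fin n → ℕ
  outdegree i = ∑[ j < n ] ⟦ arc G i j ⟧

  VertexCover : List (Fin n) → Set
  VertexCover S = ∀ {x y} → Arc G x y → x ∈ S ⊎ y ∈ S

  record Cherry (a b v : Fin n) : Set where
    constructor cherry
    field
      a≢b : a ≢ b
      a⟶v : Arc G a v
      b⟶v : Arc G b v

  arc⇒≢ : ∀ {i j} → Arc G i j → i ≢ j
  arc⇒≢ {i} i⟶i refl = T-not⇒¬T (loopless G i) i⟶i

  ⟦loop⟧≡0 : ∀ i → ⟦ arc G i i ⟧ ≡ 0
  ⟦loop⟧≡0 i = ⟦⟧≡0 (T-not⇒¬T (loopless G i))

  ⟦arc⟧+⟦reverse-arc⟧≤1 : ∀ i j → ⟦ arc G i j ⟧ + ⟦ arc G j i ⟧ ≤ 1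
  ⟦arc⟧+⟦reverse-arc⟧≤1 i j with arc G i j | arc G j i | noOpp G i j
  ... | false | false | _ = z≤n
  ... | false | true  | _ = ≤-refl
  ... | true  | false | _ = ≤-refl

  outdegree+indegree≤n : ∀ v → outdegree v + indegree v ≤ n
  outdegree+indegree≤n v = begin
    outdegree v + indegree v                    ≡⟨ ∑-distrib-+ (λ j → ⟦ arc G v j ⟧) (λ j → ⟦ arc G j v ⟧) ⟨
    ∑[ j < n ] (⟦ arc G v j ⟧ + ⟦ arc G j v ⟧)  ≤⟨ sum-mono (⟦arc⟧+⟦reverse-arc⟧≤1 v) ⟩
    ∑[ j < n ] 1                                ≡⟨ trans (sum-const n 1) (*-identityʳ n) ⟩
    n                                           ∎
    where open ≤-Reasoning

  arcCount≡∑∑ : arcCount G ≡ ∑[ i < n ] ∑[ j < n ] ⟦ arc G i j ⟧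
  arcCount≡∑∑ = trans (sumFin≡sum (λ i → sumFin (λ j → ⟦ arc G i j ⟧)))
    (sum-cong-≗ (λ i → sumFin≡sum (λ j → ⟦ arc G i j ⟧)))

  arcCount≡∑indegree : arcCount G ≡ sum indegree
  arcCount≡∑indegree = trans arcCount≡∑∑ (∑-comm (λ i j → ⟦ arc G i j ⟧))

  cover⇒in-neighbour∈ : ∀ {S i j} → VertexCover S → j ∉ S → Arc G i j → i ∈ S
  cover⇒in-neighbour∈ cover j∉S i⟶j with cover i⟶j
  ... | inj₁ i∈S = i∈S
  ... | inj₂ j∈S = contradiction j∈S j∉S

  cover⇒indegree≤ : ∀ {S j} → VertexCover S → j ∉ S → indegree j ≤ length S
  cover⇒indegree≤ {S} {j} cover j∉S =
    count-≤-length (λ i → arc G i j) S (λ i → cover⇒in-neighbour∈ cover j∉S)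

  in-neighbour∉ : ∀ {v} (ps : List (Fin n)) → length ps < indegree v → ∃[ i ] Arc G i v × i ∉ ps
  in-neighbour∉ {v} = count>length⇒∃∉ (λ i → arc G i v)

  indegree≤2⇒arcCount≤ : (ps : List (Fin n)) → (∀ j → indegree j ≤ 2) →
    (∀ j → j ∉ ps → indegree j ≤ 1) → arcCount G ≤ n + length ps
  indegree≤2⇒arcCount≤ ps ≤2 ≤1 = begin
    arcCount G                    ≡⟨ arcCount≡∑indegree ⟩
    sum indegree                  ≤⟨ ∑-≤-except ps 1 ≤1 (λ j _ → ≤2 j) ⟩
    ∑[ j < n ] 1 + 1 * length ps
      ≡⟨ cong₂ _+_ (trans (sum-const n 1) (*-identityʳ n)) (*-identityˡ (length ps)) ⟩
    n + length ps                 ∎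
    where open ≤-Reasoning

  indegree>1⇒cherry : ∀ {v} → 1 < indegree v → ∃₂ λ a b → Cherry a b v
  indegree>1⇒cherry v-in with in-neighbour∉ [] (≤-trans (s≤s z≤n) v-in)
  ... | a , a⟶v , _ with in-neighbour∉ (a ∷ []) v-in
  ...   | b , b⟶v , b∉[a] = a , b , cherry (∈∧∉⇒≢ (here refl) b∉[a]) a⟶v b⟶v

arcCount-reverse : ∀ {n} (G : OrientedGraph n) → arcCount (reverse G) ≡ arcCount G
arcCount-reverse G = trans (arcCount≡∑∑ (reverse G)) (sym (arcCount≡∑indegree G))

module _ {n : ℕ} (G : OrientedGraph n) {p q : Fin n} (p≢q : p ≢ q)
         (cover : VertexCover G (p ∷ q ∷ [])) where

  private
    P : List (Fin n)
    P = p ∷ q ∷ []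

    into : Fin n → ℕ
    into j = ⟦ arc G j p ⟧ + ⟦ arc G j q ⟧

    from : Fin n → ℕ
    from j = ⟦ arc G p j ⟧ + ⟦ arc G q j ⟧

    link≤2 : ∀ j → into j + from j ≤ 2
    link≤2 j = begin
      into j + from j
        ≡⟨ interchange ⟦ arc G j p ⟧ ⟦ arc G j q ⟧ ⟦ arc G p j ⟧ ⟦ arc G q j ⟧ ⟩
      (⟦ arc G j p ⟧ + ⟦ arc G p j ⟧) + (⟦ arc G j q ⟧ + ⟦ arc G q j ⟧)
        ≤⟨ +-mono-≤ (⟦arc⟧+⟦reverse-arc⟧≤1 G j p) (⟦arc⟧+⟦reverse-arc⟧≤1 G j q) ⟩
      2 ∎
      where open ≤-Reasoning

    into-pair≤1 : into p + into q ≤ 1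
    into-pair≤1 rewrite ⟦loop⟧≡0 G p | ⟦loop⟧≡0 G q | +-identityʳ ⟦ arc G q p ⟧ =
      ⟦arc⟧+⟦reverse-arc⟧≤1 G p q

    indegree-outside : ∀ j → j ∉ P → indegree G j ≡ from j
    indegree-outside j j∉P = begin
      indegree G j                                    ≡⟨ ∑-split₂ (λ i → ⟦ arc G i j ⟧) p≢q ⟩
      from j + sum (outside P (λ i → ⟦ arc G i j ⟧))  ≡⟨ cong (from j +_) (∑-outside-≡0 P no-arc) ⟩
      from j + 0                                      ≡⟨ +-identityʳ (from j) ⟩
      from j                                          ∎
      where
      open ≡-Reasoning
      no-arc : ∀ i → i ∉ P → ⟦ arc G i j ⟧ ≡ 0
      no-arc i i∉P = ⟦⟧≡0 (i∉P ∘ cover⇒in-neighbour∈ G cover j∉P)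

  pair-cover⇒arcCount≤ : arcCount G ≤ 1 + sum (outside P (λ _ → 2))
  pair-cover⇒arcCount≤ = begin
    arcCount G                                                     ≡⟨ arcCount≡∑indegree G ⟩
    sum (indegree G)                                               ≡⟨ ∑-split₂ (indegree G) p≢q ⟩
    indegree G p + indegree G q + sum (outside P (indegree G))
      ≤⟨ +-monoʳ-≤ _ (sum-mono (outside-mono P (λ j j∉P → ≤-reflexive (indegree-outside j j∉P)))) ⟩
    indegree G p + indegree G q + sum (outside P from)
      ≡⟨ cong (_+ sum (outside P from)) (∑-distrib-+ (λ j → ⟦ arc G j p ⟧) (λ j → ⟦ arc G j q ⟧)) ⟨
    sum into + sum (outside P from)
      ≡⟨ cong (_+ sum (outside P from)) (∑-split₂ into p≢q) ⟩
    into p + into q + sum (outside P into) + sum (outside P from)  ≡⟨ +-assoc (into p + into q) _ _ ⟩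
    into p + into q + (sum (outside P into) + sum (outside P from))
      ≡⟨ cong (into p + into q +_) sum-outside-link ⟩
    into p + into q + sum (outside P (λ j → into j + from j))
      ≤⟨ +-mono-≤ into-pair≤1 (sum-mono (outside-mono P (λ j _ → link≤2 j))) ⟩
    1 + sum (outside P (λ _ → 2))                                  ∎
    where
    open ≤-Reasoning
    sum-outside-link :
      sum (outside P into) + sum (outside P from) ≡ sum (outside P (λ j → into j + from j))
    sum-outside-link =
      trans (sym (∑-distrib-+ (outside P into) (outside P from))) (sum-cong-≗ (outside-+ P into from))

  pair-cover⇒arcCount+3≤2n : arcCount G + 3 ≤ 2 * n
  pair-cover⇒arcCount+3≤2n = begin
    arcCount G + 3                          ≤⟨ +-monoˡ-≤ 3 pair-cover⇒arcCount≤ ⟩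
    1 + sum (outside P (λ _ → 2)) + 3       ≡⟨ +-comm (1 + sum (outside P (λ _ → 2))) 3 ⟩
    2 + 2 + sum (outside P (λ _ → 2))       ≡⟨ ∑-split₂ (λ _ → 2) p≢q ⟨
    ∑[ j < n ] 2                            ≡⟨ trans (sum-const n 2) (*-comm n 2) ⟩
    2 * n                                   ∎
    where open ≤-Reasoning

Contains-trans : ∀ {n m k} {G : OrientedGraph n} {H : OrientedGraph m} {F : OrientedGraph k} →
  Contains G H → Contains H F → Contains G F
Contains-trans (φ , φ-inj , φ-hom) (ψ , ψ-inj , ψ-hom) =
  φ ∘ ψ , ψ-inj ∘ φ-inj , λ i j i⟶j → φ-hom (ψ i) (ψ j) (ψ-hom i j i⟶j)

Contains-reverse : ∀ {n k} {G : OrientedGraph n} {F : OrientedGraph k} →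
  Contains G F → Contains (reverse G) (reverse F)
Contains-reverse (φ , φ-inj , φ-hom) = φ , φ-inj , flip φ-hom

contains-lookup : ∀ {n k} {G : OrientedGraph n} {F : OrientedGraph k} (vs : Vec (Fin n) k) → Unique vs →
  (∀ i j → Arc F i j → Arc G (lookup vs i) (lookup vs j)) → Contains G F
contains-lookup vs unique hom = lookup vs , (λ {i} {j} → lookup-injective unique i j) , hom

reverse-free : ∀ {n k l} {G : OrientedGraph n} {F : OrientedGraph k} {F′ : OrientedGraph l} →
  Contains (reverse F′) F → ¬ Contains G F → ¬ Contains (reverse G) F′
reverse-free {G = G} {F} {F′} F↪F′ G-free G⊇F′ =
  G-free (Contains-trans {G = G} {reverse F′} {F} (Contains-reverse {G = reverse G} {F′} G⊇F′) F↪F′)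

inward-arcs : List (Fin 5 × Fin 5)
inward-arcs = (0F , 1F) ∷ (2F , 1F) ∷ (3F , 4F) ∷ []

arc-inward⇒∈ : ∀ i j → Arc (F⃗ inward) i j → (i , j) ∈ inward-arcs
arc-inward⇒∈ = toWitness {a? = all? λ i → all? λ j →
  T? (FArc inward i j) →-dec Any.any? (≡-dec _≟_ _≟_ (i , j)) inward-arcs} tt

opposite : Orientation → Orientation
opposite inward  = outward
opposite outward = inward

-- Reversing F⃗ o also reverses its extra arc 3 → 4, which σ turns back around.
reverse-F⃗ : ∀ o → Contains (reverse (F⃗ o)) (F⃗ (opposite o))
reverse-F⃗ o = contains-lookup {G = reverse (F⃗ o)} {F⃗ (opposite o)} σ σ-unique (σ-hom o)
  where
  σ : Vec (Fin 5) 5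
  σ = 0F ∷ 1F ∷ 2F ∷ 4F ∷ 3F ∷ []
  σ-unique : Unique σ
  σ-unique = toWitness {a? = allPairs? (λ x y → ¬? (x ≟ y)) σ} tt
  σ-hom : ∀ o i j → Arc (F⃗ (opposite o)) i j → Arc (reverse (F⃗ o)) (lookup σ i) (lookup σ j)
  σ-hom inward  = toWitness {a? = all? λ i → all? λ j →
    T? (FArc outward i j) →-dec T? (FArc inward (lookup σ j) (lookup σ i))} tt
  σ-hom outward = toWitness {a? = all? λ i → all? λ j →
    T? (FArc inward i j) →-dec T? (FArc outward (lookup σ j) (lookup σ i))} tt

module _ {n : ℕ} {G : OrientedGraph n} (free : ¬ Contains G (F⃗ inward)) where

  cherry-cover : ∀ {a b v} → Cherry G a b v → VertexCover G (v ∷ a ∷ b ∷ [])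
  cherry-cover {a} {b} {v} c {x} {y} x⟶y with x ∈? (v ∷ a ∷ b ∷ []) | y ∈? (v ∷ a ∷ b ∷ [])
  ... | yes x∈S | _       = inj₁ x∈S
  ... | no _    | yes y∈S = inj₂ y∈S
  ... | no x∉S  | no y∉S  = contradiction (contains-lookup {G = G} {F⃗ inward} vs unique hom) free
    where
    open Cherry c
    vs : Vec (Fin n) 5
    vs = a ∷ v ∷ b ∷ x ∷ y ∷ []
    v∈S : v ∈ v ∷ a ∷ b ∷ []
    v∈S = here refl
    a∈S : a ∈ v ∷ a ∷ b ∷ []
    a∈S = there (here refl)
    b∈S : b ∈ v ∷ a ∷ b ∷ []
    b∈S = there (there (here refl))
    unique : Unique vs
    unique = (arc⇒≢ G a⟶v ∷ a≢b ∷ ∈∧∉⇒≢ a∈S x∉S ∷ ∈∧∉⇒≢ a∈S y∉S ∷ [])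
           ∷ (≢-sym (arc⇒≢ G b⟶v) ∷ ∈∧∉⇒≢ v∈S x∉S ∷ ∈∧∉⇒≢ v∈S y∉S ∷ [])
           ∷ (∈∧∉⇒≢ b∈S x∉S ∷ ∈∧∉⇒≢ b∈S y∉S ∷ [])
           ∷ (arc⇒≢ G x⟶y ∷ [])
           ∷ [] ∷ []
    arcs : All (uncurry λ i j → Arc G (lookup vs i) (lookup vs j)) inward-arcs
    arcs = a⟶v ∷ b⟶v ∷ x⟶y ∷ []
    hom : ∀ i j → Arc (F⃗ inward) i j → Arc G (lookup vs i) (lookup vs j)
    hom i j i⟶j = All.lookup arcs (arc-inward⇒∈ i j i⟶j)

  module _ {a b c v : Fin n} (a≢b : a ≢ b) (a≢c : a ≢ c) (b≢c : b ≢ c)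
           (a⟶v : Arc G a v) (b⟶v : Arc G b v) (c⟶v : Arc G c v) where

    private
      abc : List (Fin n)
      abc = a ∷ b ∷ c ∷ []

      a∈abc : a ∈ abc
      a∈abc = here refl

      b∈abc : b ∈ abc
      b∈abc = there (here refl)

      c∈abc : c ∈ abc
      c∈abc = there (there (here refl))

      cover-ab : VertexCover G (v ∷ a ∷ b ∷ [])
      cover-ab = cherry-cover (cherry a≢b a⟶v b⟶v)

      cover-ac : VertexCover G (v ∷ a ∷ c ∷ [])
      cover-ac = cherry-cover (cherry a≢c a⟶v c⟶v)

      cover-bc : VertexCover G (v ∷ b ∷ c ∷ [])
      cover-bc = cherry-cover (cherry b≢c b⟶v c⟶v)

      ∉-cherry : ∀ {j x y} → j ∉ abc → j ≢ v → x ∈ abc → y ∈ abc → j ∉ v ∷ x ∷ y ∷ []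
      ∉-cherry j∉abc j≢v x∈abc y∈abc =
        All¬⇒¬Any (j≢v ∷ ≢-sym (∈∧∉⇒≢ x∈abc j∉abc) ∷ ≢-sym (∈∧∉⇒≢ y∈abc j∉abc) ∷ [])

    sole-in-neighbour : ∀ {i j} → j ∉ abc → j ≢ v → Arc G i j → i ≡ v
    sole-in-neighbour j∉abc j≢v i⟶j
      with cover⇒in-neighbour∈ G cover-ab (∉-cherry j∉abc j≢v a∈abc b∈abc) i⟶j
    ... | here i≡v = i≡v
    ... | there (here refl) =
      ∈-∷∧∉⇒≡ (cover⇒in-neighbour∈ G cover-bc (∉-cherry j∉abc j≢v b∈abc c∈abc) i⟶j)
              (All¬⇒¬Any (a≢b ∷ a≢c ∷ []))
    ... | there (there (here refl)) =
      ∈-∷∧∉⇒≡ (cover⇒in-neighbour∈ G cover-ac (∉-cherry j∉abc j≢v a∈abc c∈abc) i⟶j)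
              (All¬⇒¬Any (≢-sym a≢b ∷ b≢c ∷ []))

    indegree≤3 : ∀ {j} → j ∈ abc → indegree G j ≤ 3
    indegree≤3 (here refl) =
      cover⇒indegree≤ G cover-bc (All¬⇒¬Any (arc⇒≢ G a⟶v ∷ a≢b ∷ a≢c ∷ []))
    indegree≤3 (there (here refl)) =
      cover⇒indegree≤ G cover-ac (All¬⇒¬Any (arc⇒≢ G b⟶v ∷ ≢-sym a≢b ∷ b≢c ∷ []))
    indegree≤3 (there (there (here refl))) =
      cover⇒indegree≤ G cover-ab (All¬⇒¬Any (arc⇒≢ G c⟶v ∷ ≢-sym a≢c ∷ ≢-sym b≢c ∷ []))

    indegree≤out-arc-or-v : ∀ j → j ∉ abc → indegree G j ≤ ⟦ arc G v j ⟧ + δ v j * indegree G v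
    indegree≤out-arc-or-v j j∉abc with v ≟ j
    ... | yes refl = ≤-trans (≤-reflexive (sym (+-identityʳ (indegree G j)))) (m≤n+m _ ⟦ arc G j j ⟧)
    ... | no  v≢j  = ≤-trans (≤-reflexive (sum-supported v only-v)) (m≤m+n _ _)
      where
      only-v : ∀ i → i ≢ v → ⟦ arc G i j ⟧ ≡ 0
      only-v i i≢v = ⟦⟧≡0 (i≢v ∘ sole-in-neighbour j∉abc (≢-sym v≢j))

    three-in-neighbours⇒arcCount≤ : arcCount G ≤ n + 9
    three-in-neighbours⇒arcCount≤ = begin
      arcCount G                                               ≡⟨ arcCount≡∑indegree G ⟩
      sum (indegree G)
        ≤⟨ ∑-≤-except abc 3 indegree≤out-arc-or-v (λ _ j∈abc → ≤-trans (indegree≤3 j∈abc) (m≤n+m 3 _)) ⟩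
      ∑[ j < n ] (⟦ arc G v j ⟧ + δ v j * indegree G v) + 9
        ≡⟨ cong (_+ 9) (trans (∑-distrib-+ (λ j → ⟦ arc G v j ⟧) (λ j → δ v j * indegree G v))
                              (cong (outdegree G v +_) (∑-δ-* v (λ _ → indegree G v)))) ⟩
      outdegree G v + indegree G v + 9                         ≤⟨ +-monoˡ-≤ 9 (outdegree+indegree≤n G v) ⟩
      n + 9                                                    ∎
      where open ≤-Reasoning

  module _ {a b v s₁ s₂ w₁ : Fin n} (c : Cherry G a b v) (c₁ : Cherry G s₁ s₂ w₁)
           (w₁∉S : w₁ ∉ v ∷ a ∷ b ∷ []) where

    private
      S : List (Fin n)
      S = v ∷ a ∷ b ∷ []

      cover-S : VertexCover G S
      cover-S = cherry-cover c

      cover-w₁ : VertexCover G (w₁ ∷ s₁ ∷ s₂ ∷ [])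
      cover-w₁ = cherry-cover c₁

      ss⊆S : ∀ {x} → x ∈ s₁ ∷ s₂ ∷ [] → x ∈ S
      ss⊆S (here refl)         = cover⇒in-neighbour∈ G cover-S w₁∉S (Cherry.a⟶v c₁)
      ss⊆S (there (here refl)) = cover⇒in-neighbour∈ G cover-S w₁∉S (Cherry.b⟶v c₁)

    in-neighbour∈tails : ∀ {r w} → w ∉ w₁ ∷ S → Arc G r w → r ∈ s₁ ∷ s₂ ∷ []
    in-neighbour∈tails w∉w₁S r⟶w with cover-w₁ r⟶w
    ... | inj₁ (here refl)  = contradiction (cover⇒in-neighbour∈ G cover-S (w∉w₁S ∘ there) r⟶w) w₁∉S
    ... | inj₁ (there r∈ss) = r∈ss
    ... | inj₂ (here w≡w₁)  = contradiction (here w≡w₁) w∉w₁S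
    ... | inj₂ (there w∈ss) = contradiction (there (ss⊆S w∈ss)) w∉w₁S

    -- An arc avoiding s₁ and s₂ would have to join w₁ and w₂, which lie outside S.
    two-cherries⇒pair-cover : ∀ {r₁ r₂ w₂} → Cherry G r₁ r₂ w₂ → w₂ ∉ w₁ ∷ S →
      VertexCover G (s₁ ∷ s₂ ∷ [])
    two-cherries⇒pair-cover {r₁} {r₂} {w₂} c₂ w₂∉w₁S = cover
      where
      rs⊆ss : ∀ {x} → x ∈ r₁ ∷ r₂ ∷ [] → x ∈ s₁ ∷ s₂ ∷ []
      rs⊆ss (here refl)         = in-neighbour∈tails w₂∉w₁S (Cherry.a⟶v c₂)
      rs⊆ss (there (here refl)) = in-neighbour∈tails w₂∉w₁S (Cherry.b⟶v c₂)

      w₂≢w₁ : w₂ ≢ w₁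
      w₂≢w₁ = w₂∉w₁S ∘ here

      misses-S : ∀ {x y} → Arc G x y → x ∉ S → y ∉ S → ⊥
      misses-S x⟶y x∉S y∉S = [ x∉S , y∉S ]′ (cover-S x⟶y)

      cover : VertexCover G (s₁ ∷ s₂ ∷ [])
      cover x⟶y with cover-w₁ x⟶y | cherry-cover c₂ x⟶y
      ... | inj₁ (there x∈ss) | _                 = inj₁ x∈ss
      ... | inj₂ (there y∈ss) | _                 = inj₂ y∈ss
      ... | _                 | inj₁ (there x∈rs) = inj₁ (rs⊆ss x∈rs)
      ... | _                 | inj₂ (there y∈rs) = inj₂ (rs⊆ss y∈rs)
      ... | inj₁ (here refl)  | inj₁ (here refl)  = contradiction refl w₂≢w₁
      ... | inj₂ (here refl)  | inj₂ (here refl)  = contradiction refl w₂≢w₁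
      ... | inj₁ (here refl)  | inj₂ (here refl)  = ⊥-elim (misses-S x⟶y w₁∉S (w₂∉w₁S ∘ there))
      ... | inj₂ (here refl)  | inj₁ (here refl)  = ⊥-elim (misses-S x⟶y (w₂∉w₁S ∘ there) w₁∉S)

  indegree>2⇒arcCount≤ : ∀ {v} → 2 < indegree G v → arcCount G ≤ n + 9
  indegree>2⇒arcCount≤ v-in with in-neighbour∉ G [] (≤-trans (s≤s z≤n) v-in)
  ... | a , a⟶v , _ with in-neighbour∉ G (a ∷ []) (≤-trans (s≤s (s≤s z≤n)) v-in)
  ...   | b , b⟶v , b∉a with in-neighbour∉ G (a ∷ b ∷ []) v-in
  ...     | c , c⟶v , c∉ab =
    three-in-neighbours⇒arcCount≤ (∈∧∉⇒≢ (here refl) b∉a) (∈∧∉⇒≢ (here refl) c∉ab)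
      (∈∧∉⇒≢ (there (here refl)) c∉ab) a⟶v b⟶v c⟶v

  module _ (n≥12 : 12 ≤ n) (in≤2 : ∀ j → indegree G j ≤ 2) where

    private
      all-but≤1⇒arcCount≤ : ∀ ps → length ps ≤ 9 → (∀ j → j ∉ ps → indegree G j ≤ 1) →
        arcCount G ≤ 2 * n ∸ 3
      all-but≤1⇒arcCount≤ ps ps≤9 in≤1 =
        ≤n+9⇒≤2n∸3 n≥12 (≤-trans (indegree≤2⇒arcCount≤ G ps in≤2 in≤1) (+-monoʳ-≤ n ps≤9))

    max-indegree≤2⇒arcCount≤ : arcCount G ≤ 2 * n ∸ 3
    max-indegree≤2⇒arcCount≤ with ∃>-or-∀≤ (indegree G) [] 1
    ... | inj₂ in≤1 = all-but≤1⇒arcCount≤ [] z≤n in≤1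
    ... | inj₁ (v , _ , v-in>1) with indegree>1⇒cherry G v-in>1
    ...   | a , b , c with ∃>-or-∀≤ (indegree G) (v ∷ a ∷ b ∷ []) 1
    ...     | inj₂ in≤1 = all-but≤1⇒arcCount≤ (v ∷ a ∷ b ∷ []) (m≤m+n 3 6) in≤1
    ...     | inj₁ (w₁ , w₁∉S , w₁-in>1) with indegree>1⇒cherry G w₁-in>1
    ...       | s₁ , s₂ , c₁ with ∃>-or-∀≤ (indegree G) (w₁ ∷ v ∷ a ∷ b ∷ []) 1
    ...         | inj₂ in≤1 = all-but≤1⇒arcCount≤ (w₁ ∷ v ∷ a ∷ b ∷ []) (m≤m+n 4 5) in≤1
    ...         | inj₁ (w₂ , w₂∉w₁S , w₂-in>1) with indegree>1⇒cherry G w₂-in>1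
    ...           | _ , _ , c₂ = m+n≤o⇒m≤o∸n (arcCount G)
      (pair-cover⇒arcCount+3≤2n G (Cherry.a≢b c₁) (two-cherries⇒pair-cover c c₁ w₁∉S c₂ w₂∉w₁S))

  arcCount≤2n∸3 : 12 ≤ n → arcCount G ≤ 2 * n ∸ 3
  arcCount≤2n∸3 n≥12 with ∃>-or-∀≤ (indegree G) [] 2
  ... | inj₁ (v , _ , v-in>2) = ≤n+9⇒≤2n∸3 n≥12 (indegree>2⇒arcCount≤ v-in>2)
  ... | inj₂ in≤2 = max-indegree≤2⇒arcCount≤ n≥12 (λ j → in≤2 j λ ())

two-sources-arc : ∀ {n} → Fin n → Fin n → Bool
two-sources-arc 0F (suc _)       = true
two-sources-arc 1F (suc (suc _)) = true
two-sources-arc _  _             = false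

two-sources-loopless : ∀ {n} (i : Fin n) → T (not (two-sources-arc i i))
two-sources-loopless 0F            = tt
two-sources-loopless 1F            = tt
two-sources-loopless (suc (suc _)) = tt

two-sources-noOpp : ∀ {n} (i j : Fin n) → T (not (two-sources-arc i j ∧ two-sources-arc j i))
two-sources-noOpp 0F            0F            = tt
two-sources-noOpp 0F            1F            = tt
two-sources-noOpp 0F            (suc (suc _)) = tt
two-sources-noOpp 1F            0F            = tt
two-sources-noOpp 1F            1F            = tt
two-sources-noOpp 1F            (suc (suc _)) = tt
two-sources-noOpp (suc (suc _)) _             = tt

TwoSources : ∀ n → OrientedGraph n
TwoSources n = record
  { arc = two-sources-arc ; loopless = two-sources-loopless ; noOpp = two-sources-noOpp }

tail∈01 : ∀ {m} {i j : Fin (2 + m)} → Arc (TwoSources (2 + m)) i j → i ∈ 0F ∷ 1F ∷ []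
tail∈01 {i = 0F} _ = here refl
tail∈01 {i = 1F} _ = there (here refl)

pigeonhole₂ : ∀ {A : Set} {p q x y z : A} → x ∈ p ∷ q ∷ [] → y ∈ p ∷ q ∷ [] → z ∈ p ∷ q ∷ [] →
  x ≡ y ⊎ x ≡ z ⊎ y ≡ z
pigeonhole₂ (here refl)         (here refl)         _                   = inj₁ refl
pigeonhole₂ (there (here refl)) (there (here refl)) _                   = inj₁ refl
pigeonhole₂ (here refl)         (there (here refl)) (here refl)         = inj₂ (inj₁ refl)
pigeonhole₂ (here refl)         (there (here refl)) (there (here refl)) = inj₂ (inj₂ refl)
pigeonhole₂ (there (here refl)) (here refl)         (here refl)         = inj₂ (inj₂ refl)
pigeonhole₂ (there (here refl)) (here refl)         (there (here refl)) = inj₂ (inj₁ refl)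

TwoSources-free : ∀ m → ¬ Contains (TwoSources (2 + m)) (F⃗ inward)
TwoSources-free m (φ , φ-inj , hom)
  with pigeonhole₂ (tail∈01 (hom 0F 1F tt)) (tail∈01 (hom 2F 1F tt)) (tail∈01 (hom 3F 4F tt))
... | inj₁ φ0≡φ2        = contradiction (φ-inj φ0≡φ2) λ ()
... | inj₂ (inj₁ φ0≡φ3) = contradiction (φ-inj φ0≡φ3) λ ()
... | inj₂ (inj₂ φ2≡φ3) = contradiction (φ-inj φ2≡φ3) λ ()

arcCount-TwoSources : ∀ m → arcCount (TwoSources (2 + m)) ≡ 2 * (2 + m) ∸ 3
arcCount-TwoSources m = begin
  arcCount (TwoSources (2 + m))
    ≡⟨ arcCount≡∑∑ (TwoSources (2 + m)) ⟩
  ∑[ j < 1 + m ] 1 + (∑[ j < m ] 1 + ∑[ i < m ] ∑[ j < 2 + m ] 0)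
    ≡⟨ cong₂ _+_ (sum-const (1 + m) 1) (cong₂ _+_ (sum-const m 1) no-further-arcs) ⟩
  (1 + m) * 1 + (m * 1 + 0)
    ≡⟨ m+n∸m≡n 3 _ ⟨
  3 + ((1 + m) * 1 + (m * 1 + 0)) ∸ 3
    ≡⟨ cong (_∸ 3) (2[2+k]≡3+count m) ⟩
  2 * (2 + m) ∸ 3 ∎
  where
  open ≡-Reasoning
  2[2+k]≡3+count : ∀ k → 3 + ((1 + k) * 1 + (k * 1 + 0)) ≡ 2 * (2 + k)
  2[2+k]≡3+count = solve-∀
  no-further-arcs : ∑[ i < m ] ∑[ j < 2 + m ] 0 ≡ 0
  no-further-arcs = trans (sum-cong-≗ {m} (λ _ → sum-replicate-zero (2 + m))) (sum-replicate-zero m)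

isExOri-inward : ∀ n → 12 ≤ n → IsExOri n (F⃗ inward) (2 * n ∸ 3)
isExOri-inward (suc (suc m)) n≥12 =
  (TwoSources (2 + m) , TwoSources-free m , arcCount-TwoSources m) ,
  λ G G-free → arcCount≤2n∸3 {G = G} G-free n≥12
isExOri-inward 1 (s≤s ())

isExOri-reverse : ∀ {n m k l} {F : OrientedGraph k} {F′ : OrientedGraph l} →
  Contains (reverse F′) F → Contains (reverse F) F′ → IsExOri n F m → IsExOri n F′ m
isExOri-reverse {F = F} {F′} F↪F′ F′↪F ((G , G-free , G-count) , bound) =
  (reverse G , reverse-free {G = G} {F} {F′} F↪F′ G-free , trans (arcCount-reverse G) G-count) ,
  λ H H-free → ≤-trans (≤-reflexive (sym (arcCount-reverse H)))
                       (bound (reverse H) (reverse-free {G = H} {F′} {F} F′↪F H-free))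

proposition2p7 : (o : Orientation) →
    Σ ℕ λ n₀ → ∀ n → n₀ ≤ n → IsExOri n (F⃗ o) (2 * n ∸ 3)
proposition2p7 inward  = 12 , isExOri-inward
proposition2p7 outward = 12 , λ n n≥12 →
  isExOri-reverse {F = F⃗ inward} {F⃗ outward} (reverse-F⃗ outward) (reverse-F⃗ inward)
    (isExOri-inward n n≥12)
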